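{- Let $q>1$ be odd and $p=2$. For all $U\in\mathbb{N}$, $$W(qU)=W(U)+W(qU-1),$$ $$W(qU+1)=\begin{cases}W(U)+W\!\left(\frac{qU}{2}-1\right)&\text{for even }U,\\ W(U)+W\!\left(\frac{qU+1}{2}\right)&\text{for odd }U,\end{cases}$$ and $W(qU+r)=W\!\left(\left\lfloor\frac{qU+r}{2}\right\rfloor\right)$ for $2\le r\le q-1$.
   Context: A strictly chained $(2,q)$-ary partition of an integer $U$ is a finite sequence of distinct positive integers of the form $2^aq^b$ ($a,b\ge0$) summing to $U$, in decreasing order, each part a multiple of the next. $W(U)$ is the number of such partitions of $U$, with $W(0)=1$ (the empty partition) and $W(x)=0$ if $x$ is not a nonnegative integer. -}

module Defs where

open import Data.Nat using (ℕ; zero; suc; _+_; _*_; _^_; _≡ᵇ_; _<ᵇ_)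
open import Data.Nat.Divisibility using (_∣?_)
open import Data.Bool using (Bool; true; false; _∧_; if_then_else_)
open import Data.List using (List; []; _∷_; map; _++_; length; downFrom; upTo)
open import Data.Nat.ListAction using (sum)
open import Data.Bool.ListAction using (any)
open import Data.Integer using (ℤ; +_; -[1+_])
open import Relation.Nullary using (does)

-- Is n of the form 2^a * q^b for some a, b ≥ 0?
-- (For q ≥ 2 any such a, b satisfy a, b ≤ n, so the bounded search is exact.)
isPart : ℕ → ℕ → Bool
isPart q n = any (λ a → any (λ b → (2 ^ a) * (q ^ b) ≡ᵇ n) (upTo (suc n))) (upTo (suc n))

chainOK : ℕ → List ℕ → Bool
chainOK q [] = true
chainOK q (x ∷ []) = isPart q x
chainOK q (x ∷ y ∷ r) = isPart q x ∧ (y <ᵇ x) ∧ does (y ∣? x) ∧ chainOK q (y ∷ r)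

sublists : {A : Set} → List A → List (List A)
sublists [] = [] ∷ []
sublists (x ∷ xs) = map (x ∷_) (sublists xs) ++ sublists xs

countB : {A : Set} → (A → Bool) → List A → ℕ
countB p [] = 0
countB p (x ∷ xs) = if p x then suc (countB p xs) else countB p xs

-- W q U : number of strictly chained (2,q)-ary partitions of U.
-- Every such partition is a strictly decreasing list of integers in [1..U],
-- i.e. a sublist of [U, U-1, ..., 1]; we count those summing to U that are chained.
W : ℕ → ℕ → ℕ
W q U = countB (λ l → (sum l ≡ᵇ U) ∧ chainOK q l) (sublists (map suc (downFrom U)))

Wℤ : ℕ → ℤ → ℕ
Wℤ q (+ n) = W q n
Wℤ q -[1+ n ] = 0

-- Besides W we count
--   W≥2 n    : partitions of n all of whose parts are at least 2, and
--   Wmul k n : partitions of n all of whose parts are multiples of k.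
-- Everything rests on four facts about these counts:
--  (a) W (n+1) = W≥2 n + W≥2 (n+1): a partition of n+1 either ends in the part 1,
--      whose removal leaves a partition of n into parts ≥ 2, or has no part 1;
--  (b) W≥2 n + Wmul 2q n = Wmul 2 n + Wmul q n: in a chained partition every part
--      is a multiple of the smallest one, a number 2^a q^b ≥ 2, so either all parts
--      are even or all are multiples of q (inclusion–exclusion);
--  (c) Wmul k (k m) = W m for k ∈ {2, q, 2q}: divide every part by k;
--  (d) Wmul k n = 0 when k ∤ n.  The first
-- recurrence is proved by strong induction on U; the others follow directly,
-- the even case of the second one using the first at U/2.

module Submission where

open import Defs
open import Data.Nat
  using (ℕ; zero; suc; _+_; _*_; _^_; _∸_; _/_; _%_; _≤_; _<_; _≤ᵇ_; _<ᵇ_; _≡ᵇ_; z≤n; s≤s; z<s; NonZero; >-nonZero; >-nonZero⁻¹; ≢-nonZero⁻¹)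
open import Data.Nat.Properties
open import Data.Nat.Divisibility
open import Data.Nat.DivMod using (m*n/n≡m; +-distrib-/-∣ʳ)
open import Data.Nat.Coprimality using (Coprime; coprime-divisor) renaming (sym to coprime-sym)
open import Data.Nat.Induction using (<-rec)
open import Data.Nat.Solver using (module +-*-Solver)
open import Data.Nat.ListAction using (sum)
open import Data.Nat.ListAction.Properties using (sum-++)
open import Data.Bool using (Bool; true; false; _∧_; _∨_; T)
open import Data.Bool.Properties using (∧-identityʳ; ∧-zeroʳ; ∨-zeroʳ)
open import Data.Bool.ListAction using (all)
open import Data.List using (List; []; _∷_; [_]; map; _++_; downFrom; upTo; filterᵇ)
open import Data.List.Relation.Unary.Any using (satisfied)
open import Data.List.Relation.Unary.Any.Properties using (any⁺; any⁻)
open import Data.List.Membership.Propositional using (lose)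
open import Data.List.Membership.Propositional.Properties using (∈-upTo⁺)
open import Data.Product using (_×_; _,_; proj₁; proj₂; ∃₂)
open import Data.Sum using (_⊎_; inj₁; inj₂)
open import Data.Unit using (tt)
open import Data.Empty using (⊥-elim)
open import Relation.Nullary using (¬_; yes; no; does; contradiction)
open import Relation.Nullary.Decidable using (dec-true)
open import Relation.Binary.PropositionalEquality using (_≡_; _≢_; refl; sym; trans; cong; cong₂; subst; module ≡-Reasoning)

∧-elimˡ : ∀ {a b} → a ∧ b ≡ true → a ≡ true
∧-elimˡ {true} _ = refl

∧-elimʳ : ∀ {a b} → a ∧ b ≡ true → b ≡ true
∧-elimʳ {true} e = e

∧-intro : ∀ {a b} → a ≡ true → b ≡ true → a ∧ b ≡ true
∧-intro refl refl = refl

¬true⇒false : ∀ {b} → ¬ b ≡ true → b ≡ false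
¬true⇒false {false} _ = refl
¬true⇒false {true} h = ⊥-elim (h refl)

true-ext : ∀ {a b} → (a ≡ true → b ≡ true) → (b ≡ true → a ≡ true) → a ≡ b
true-ext {false} {false} _ _ = refl
true-ext {false} {true} _ g = g refl
true-ext {true} f _ = sym (f refl)

T⇒true : ∀ {b} → T b → b ≡ true
T⇒true {true} _ = refl

true⇒T : ∀ {b} → b ≡ true → T b
true⇒T refl = tt

∧-interchange : ∀ a b c d → (a ∧ b) ∧ (c ∧ d) ≡ (a ∧ c) ∧ (b ∧ d)
∧-interchange true b true d = refl
∧-interchange true b false d = ∧-zeroʳ b
∧-interchange false b c d = refl

∧-distribˡ-∧ : ∀ p a b → p ∧ (a ∧ b) ≡ (p ∧ a) ∧ (p ∧ b)
∧-distribˡ-∧ true a b = refl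
∧-distribˡ-∧ false a b = refl

∧-∨-cover : ∀ p a b → (p ≡ true → a ≡ true ⊎ b ≡ true) → p ≡ (p ∧ a) ∨ (p ∧ b)
∧-∨-cover false a b _ = refl
∧-∨-cover true a b h with h refl
... | inj₁ refl = refl
... | inj₂ refl = sym (∨-zeroʳ a)

module _ {A : Set} where

  countB-++ : (p : A → Bool) (xs ys : List A) → countB p (xs ++ ys) ≡ countB p xs + countB p ys
  countB-++ p [] ys = refl
  countB-++ p (x ∷ xs) ys with p x
  ... | true = cong suc (countB-++ p xs ys)
  ... | false = countB-++ p xs ys

  countB-none : (p : A → Bool) (xs : List A) → (∀ x → p x ≡ false) → countB p xs ≡ 0
  countB-none p [] _ = refl
  countB-none p (x ∷ xs) h rewrite h x = countB-none p xs h

  countB-cong : (p p′ : A → Bool) (xs : List A) → (∀ x → p x ≡ p′ x) → countB p xs ≡ countB p′ xs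
  countB-cong p p′ [] _ = refl
  countB-cong p p′ (x ∷ xs) h rewrite h x with p′ x
  ... | true = cong suc (countB-cong p p′ xs h)
  ... | false = countB-cong p p′ xs h

  countB-∨-∧ : (p p′ : A → Bool) (xs : List A) →
    countB (λ x → p x ∨ p′ x) xs + countB (λ x → p x ∧ p′ x) xs ≡ countB p xs + countB p′ xs
  countB-∨-∧ p p′ [] = refl
  countB-∨-∧ p p′ (x ∷ xs) with p x | p′ x
  ... | true | true = cong suc (trans (+-suc _ _) (trans (cong suc (countB-∨-∧ p p′ xs)) (sym (+-suc _ _))))
  ... | true | false = cong suc (countB-∨-∧ p p′ xs)
  ... | false | true = trans (cong suc (countB-∨-∧ p p′ xs)) (sym (+-suc _ _))
  ... | false | false = countB-∨-∧ p p′ xs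

countB-map : {A B : Set} (p : B → Bool) (f : A → B) (xs : List A) →
  countB p (map f xs) ≡ countB (λ x → p (f x)) xs
countB-map p f [] = refl
countB-map p f (x ∷ xs) with p (f x)
... | true = cong suc (countB-map p f xs)
... | false = countB-map p f xs

module _ {A : Set} where

  countSub-∷ : (p : List A → Bool) (x : A) (xs : List A) →
    countB p (sublists (x ∷ xs)) ≡ countB (λ l → p (x ∷ l)) (sublists xs) + countB p (sublists xs)
  countSub-∷ p x xs = trans (countB-++ p (map (x ∷_) (sublists xs)) (sublists xs))
                            (cong (_+ countB p (sublists xs)) (countB-map p (x ∷_) (sublists xs)))

  countSub-∷-unused : (p : List A → Bool) (x : A) (xs : List A) → (∀ l → p (x ∷ l) ≡ false) →
    countB p (sublists (x ∷ xs)) ≡ countB p (sublists xs)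
  countSub-∷-unused p x xs h =
    trans (countSub-∷ p x xs) (cong (_+ countB p (sublists xs)) (countB-none _ (sublists xs) h))

  countSub-cong : (g : A → Bool) (p p′ : List A → Bool) (xs : List A) → all g xs ≡ true →
    (∀ l → all g l ≡ true → p l ≡ p′ l) → countB p (sublists xs) ≡ countB p′ (sublists xs)
  countSub-cong g p p′ [] _ h rewrite h [] refl = refl
  countSub-cong g p p′ (x ∷ xs) gxs h = begin
    countB p (sublists (x ∷ xs))
      ≡⟨ countSub-∷ p x xs ⟩
    countB (λ l → p (x ∷ l)) (sublists xs) + countB p (sublists xs)
      ≡⟨ cong₂ _+_ (countSub-cong g _ _ xs (∧-elimʳ gxs) (λ l gl → h (x ∷ l) (∧-intro (∧-elimˡ gxs) gl)))
                   (countSub-cong g p p′ xs (∧-elimʳ gxs) h) ⟩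
    countB (λ l → p′ (x ∷ l)) (sublists xs) + countB p′ (sublists xs)
      ≡⟨ countSub-∷ p′ x xs ⟨
    countB p′ (sublists (x ∷ xs)) ∎
    where open ≡-Reasoning

  countSub-filter : (g : A → Bool) (p : List A → Bool) (xs : List A) →
    (∀ l → p l ≡ true → all g l ≡ true) → countB p (sublists xs) ≡ countB p (sublists (filterᵇ g xs))
  countSub-filter g p [] _ = refl
  countSub-filter g p (x ∷ xs) h with g x in gx
  ... | true = trans (countSub-∷ p x xs) (trans
        (cong₂ _+_ (countSub-filter g _ xs (λ l e → ∧-elimʳ (h (x ∷ l) e))) (countSub-filter g p xs h))
        (sym (countSub-∷ p x (filterᵇ g xs))))
  ... | false = trans (countSub-∷-unused p x xs x-unused) (countSub-filter g p xs h)
    where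
    x-unused : ∀ l → p (x ∷ l) ≡ false
    x-unused l = ¬true⇒false (λ e → contradiction (trans (sym (∧-elimˡ (h (x ∷ l) e))) gx) λ ())

  countSub-∷ʳ : (p : List A → Bool) (xs : List A) (y : A) →
    countB p (sublists (xs ++ [ y ])) ≡ countB (λ l → p (l ++ [ y ])) (sublists xs) + countB p (sublists xs)
  countSub-∷ʳ p [] y with p [ y ] | p []
  ... | true | true = refl
  ... | true | false = refl
  ... | false | true = refl
  ... | false | false = refl
  countSub-∷ʳ p (x ∷ xs) y = begin
    countB p (sublists (x ∷ xs ++ [ y ]))
      ≡⟨ countSub-∷ p x (xs ++ [ y ]) ⟩
    countB (λ l → p (x ∷ l)) (sublists (xs ++ [ y ])) + countB p (sublists (xs ++ [ y ]))
      ≡⟨ cong₂ _+_ (countSub-∷ʳ (λ l → p (x ∷ l)) xs y) (countSub-∷ʳ p xs y) ⟩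
    (a + b) + (c + d)
      ≡⟨ solve 4 (λ a b c d → (a :+ b) :+ (c :+ d) := (a :+ c) :+ (b :+ d)) refl a b c d ⟩
    (a + c) + (b + d)
      ≡⟨ cong₂ _+_ (countSub-∷ (λ l → p (l ++ [ y ])) x xs) (countSub-∷ p x xs) ⟨
    countB (λ l → p (l ++ [ y ])) (sublists (x ∷ xs)) + countB p (sublists (x ∷ xs)) ∎
    where
    open ≡-Reasoning
    open +-*-Solver using (solve; _:+_; _:=_)
    a b c d : ℕ
    a = countB (λ l → p (x ∷ l ++ [ y ])) (sublists xs)
    b = countB (λ l → p (x ∷ l)) (sublists xs)
    c = countB (λ l → p (l ++ [ y ])) (sublists xs)
    d = countB p (sublists xs)

countSub-map : {A B : Set} (p : List B → Bool) (f : A → B) (xs : List A) →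
  countB p (sublists (map f xs)) ≡ countB (λ l → p (map f l)) (sublists xs)
countSub-map p f [] = refl
countSub-map p f (x ∷ xs) = trans (countSub-∷ p (f x) (map f xs)) (trans
  (cong₂ _+_ (countSub-map (λ l → p (f x ∷ l)) f xs) (countSub-map p f xs))
  (sym (countSub-∷ (λ l → p (map f l)) x xs)))

all-filterᵇ : {A : Set} (g : A → Bool) (xs : List A) → all g (filterᵇ g xs) ≡ true
all-filterᵇ g [] = refl
all-filterᵇ g (x ∷ xs) with g x in gx
... | true = ∧-intro gx (all-filterᵇ g xs)
... | false = all-filterᵇ g xs

even-or-suc-even : ∀ n → 2 ∣ n ⊎ 2 ∣ suc n
even-or-suc-even zero = inj₁ (divides 0 refl)
even-or-suc-even (suc n) with even-or-suc-even n
... | inj₁ 2∣n = inj₂ (∣m∣n⇒∣m+n (∣-refl {2}) 2∣n)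
... | inj₂ 2∣1+n = inj₁ 2∣1+n

even⇒suc-odd : ∀ {n} → 2 ∣ n → ¬ 2 ∣ suc n
even⇒suc-odd {n} 2∣n 2∣1+n = contradiction (∣⇒≤ 2∣1) λ { (s≤s ()) }
  where
  2∣1 : 2 ∣ 1
  2∣1 = ∣m+n∣m⇒∣n (subst (2 ∣_) (+-comm 1 n) 2∣1+n) 2∣n

odd⇒suc-even : ∀ {n} → ¬ 2 ∣ n → 2 ∣ suc n
odd⇒suc-even {n} 2∤n with even-or-suc-even n
... | inj₁ 2∣n = contradiction 2∣n 2∤n
... | inj₂ 2∣1+n = 2∣1+n

suc-even/2 : ∀ {n} → 2 ∣ n → suc n / 2 ≡ n / 2
suc-even/2 2∣n = +-distrib-/-∣ʳ 1 2∣n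

∤-below : ∀ {d s} → 0 < s → s < d → ¬ d ∣ s
∤-below {s = suc _} _ s<d d∣s = <⇒≱ s<d (∣⇒≤ d∣s)

∤-offset : ∀ {d m s} → d ∣ m → 0 < s → s < d → ¬ d ∣ m + s
∤-offset d∣m 0<s s<d d∣m+s = ∤-below 0<s s<d (∣m+n∣m⇒∣n d∣m+s d∣m)

n<b^n : ∀ {b} → 1 < b → ∀ n → n < b ^ n
n<b^n 1<b zero = s≤s z≤n
n<b^n {b} 1<b (suc n) =
  ≤-<-trans (n<b^n 1<b n) (subst (b ^ n <_) (*-comm (b ^ n) b) (m<m*n (b ^ n) b {{b^n≢0}} 1<b))
  where
  b^n≢0 : NonZero (b ^ n)
  b^n≢0 = m^n≢0 b n {{>-nonZero (<-trans z<s 1<b)}}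

divB : ℕ → ℕ → Bool
divB k x = does (k ∣? x)

divB-sound : ∀ k x → divB k x ≡ true → k ∣ x
divB-sound k x e with k ∣? x
... | yes k∣x = k∣x
... | no _ = contradiction e λ ()

divB-complete : ∀ k x → k ∣ x → divB k x ≡ true
divB-complete k x = dec-true (k ∣? x)

all-divB⇒∣sum : ∀ k l → all (divB k) l ≡ true → k ∣ sum l
all-divB⇒∣sum k [] _ = k ∣0
all-divB⇒∣sum k (x ∷ l) e =
  ∣m∣n⇒∣m+n (divB-sound k x (∧-elimˡ {divB k x} e)) (all-divB⇒∣sum k l (∧-elimʳ {divB k x} e))

all-divB-map* : ∀ k l → all (divB k) (map (k *_) l) ≡ true
all-divB-map* k [] = refl
all-divB-map* k (x ∷ l) = ∧-intro (divB-complete k (k * x) (m∣m*n x)) (all-divB-map* k l)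

sum-map* : ∀ k l → sum (map (k *_) l) ≡ k * sum l
sum-map* k [] = sym (*-zeroʳ k)
sum-map* k (x ∷ l) = trans (cong (k * x +_) (sum-map* k l)) (sym (*-distribˡ-+ k x (sum l)))

module _ (k : ℕ) .{{_ : NonZero k}} where

  ≡ᵇ-scale : ∀ m n → (k * m ≡ᵇ k * n) ≡ (m ≡ᵇ n)
  ≡ᵇ-scale m n = true-ext
    (λ e → T⇒true (≡⇒≡ᵇ _ _ (*-cancelˡ-≡ m n k (≡ᵇ⇒≡ _ _ (true⇒T e)))))
    (λ e → T⇒true (≡⇒≡ᵇ _ _ (cong (k *_) (≡ᵇ⇒≡ _ _ (true⇒T e)))))

  <ᵇ-scale : ∀ m n → (k * m <ᵇ k * n) ≡ (m <ᵇ n)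
  <ᵇ-scale m n = true-ext
    (λ e → T⇒true (<⇒<ᵇ (*-cancelˡ-< k m n (<ᵇ⇒< _ _ (true⇒T e)))))
    (λ e → T⇒true (<⇒<ᵇ (*-monoʳ-< k (<ᵇ⇒< _ _ (true⇒T e)))))

  divB-scale : ∀ m n → divB (k * m) (k * n) ≡ divB m n
  divB-scale m n = true-ext
    (λ e → divB-complete m n (*-cancelˡ-∣ k (divB-sound (k * m) (k * n) e)))
    (λ e → divB-complete (k * m) (k * n) (*-monoʳ-∣ k (divB-sound m n e)))

  multiple-in-window : ∀ {m x} → k ∣ x → k * m ≤ x → x < k * m + k → x ≡ k * m
  multiple-in-window {m} (divides c refl) lo hi = trans (cong (_* k) c≡m) (*-comm m k)
    where
    m≤c : m ≤ c
    m≤c = *-cancelʳ-≤ m c k (subst (_≤ c * k) (*-comm k m) lo)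
    c<1+m : c < suc m
    c<1+m = *-cancelʳ-< k c (suc m) (subst (c * k <_) (trans (+-comm (k * m) k) (cong (k +_) (*-comm k m))) hi)
    c≡m : c ≡ m
    c≡m = ≤-antisym (≤-pred c<1+m) m≤c

Cand : ℕ → List ℕ
Cand n = map suc (downFrom n)

Cand≥2 : ℕ → List ℕ
Cand≥2 n = filterᵇ (2 ≤ᵇ_) (Cand n)

Cand-suc : ∀ n → Cand (suc n) ≡ Cand≥2 (suc n) ++ [ 1 ]
Cand-suc zero = refl
Cand-suc (suc n) = cong (suc (suc n) ∷_) (Cand-suc n)

multiples-in-Cand : ∀ k .{{_ : NonZero k}} n m → k * m ≤ n → n < k * m + k →
  filterᵇ (divB k) (Cand n) ≡ map (k *_) (Cand m)
multiples-in-Cand k zero zero _ _ = refl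
multiples-in-Cand k zero (suc m) km≤0 _ = contradiction km≤0 (<⇒≱ (>-nonZero⁻¹ (k * suc m) {{m*n≢0 k (suc m)}}))
multiples-in-Cand k (suc n) m lo hi with k ∣? suc n
... | no k∤1+n = multiples-in-Cand k n m (≤-pred (≤∧≢⇒< lo km≢1+n)) (<-trans (n<1+n n) hi)
  where
  km≢1+n : k * m ≢ suc n
  km≢1+n e = k∤1+n (subst (k ∣_) e (m∣m*n m))
... | yes k∣1+n with m | multiple-in-window k k∣1+n lo hi
...   | zero | 1+n≡0 = contradiction (trans 1+n≡0 (*-zeroʳ k)) λ ()
...   | suc m′ | 1+n≡k[1+m′] = cong₂ _∷_ 1+n≡k[1+m′] (multiples-in-Cand k n m′ lo′ hi′)
  where
  1+n≡km′+k : suc n ≡ k * m′ + k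
  1+n≡km′+k = trans 1+n≡k[1+m′] (trans (*-suc k m′) (+-comm k (k * m′)))
  lo′ : k * m′ ≤ n
  lo′ = ≤-pred (subst (k * m′ <_) (sym 1+n≡km′+k) (m<m+n (k * m′) (>-nonZero⁻¹ k)))
  hi′ : n < k * m′ + k
  hi′ = subst (n <_) 1+n≡km′+k (n<1+n n)

module Chains (q : ℕ) (1<q : 1 < q) where

  instance
    q≢0 : NonZero q
    q≢0 = >-nonZero (<-trans z<s 1<q)

  IsPart : ℕ → Set
  IsPart n = ∃₂ λ a b → 2 ^ a * q ^ b ≡ n

  isPart-sound : ∀ n → isPart q n ≡ true → IsPart n
  isPart-sound n e with satisfied (any⁻ _ (upTo (suc n)) (true⇒T e))
  ... | a , found-b with satisfied (any⁻ _ (upTo (suc n)) found-b)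
  ... | b , found = a , b , ≡ᵇ⇒≡ _ _ found

  isPart-complete : ∀ n → IsPart n → isPart q n ≡ true
  isPart-complete n (a , b , e) =
    T⇒true (any⁺ _ (lose (∈-upTo⁺ a≤n) (any⁺ _ (lose (∈-upTo⁺ b≤n) (≡⇒≡ᵇ _ _ e)))))
    where
    instance
      2^a≢0 : NonZero (2 ^ a)
      2^a≢0 = m^n≢0 2 a
      q^b≢0 : NonZero (q ^ b)
      q^b≢0 = m^n≢0 q b
    a≤n : a < suc n
    a≤n = s≤s (≤-trans (<⇒≤ (n<b^n ≤-refl a)) (subst (2 ^ a ≤_) e (m≤m*n (2 ^ a) (q ^ b))))
    b≤n : b < suc n
    b≤n = s≤s (≤-trans (<⇒≤ (n<b^n 1<q b)) (subst (q ^ b ≤_) e (m≤n*m (q ^ b) (2 ^ a))))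

  part-divisor : ∀ x → isPart q x ≡ true → 2 ≤ x → 2 ∣ x ⊎ q ∣ x
  part-divisor x e 2≤x with isPart-sound x e
  ... | zero , zero , refl = contradiction 2≤x λ { (s≤s ()) }
  ... | suc a , b , refl = inj₁ (divides (2 ^ a * q ^ b) (trans (*-assoc 2 (2 ^ a) (q ^ b)) (*-comm 2 (2 ^ a * q ^ b))))
  ... | zero , suc b , refl = inj₂ (divides (q ^ b) (trans (+-identityʳ (q * q ^ b)) (*-comm q (q ^ b))))

  part-positive : ∀ x → isPart q x ≡ true → 0 < x
  part-positive (suc x) _ = z<s

  chain-step : ∀ x y r → chainOK q (x ∷ y ∷ r) ≡ true → y ∣ x × chainOK q (y ∷ r) ≡ true
  chain-step x y r e = divB-sound y x (∧-elimˡ {divB y x} rest) , ∧-elimʳ {divB y x} rest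
    where
    rest : divB y x ∧ chainOK q (y ∷ r) ≡ true
    rest = ∧-elimʳ {y <ᵇ x} (∧-elimʳ {isPart q x} e)

  chain-parts : ∀ l → chainOK q l ≡ true → all (isPart q) l ≡ true
  chain-parts [] _ = refl
  chain-parts (x ∷ []) e = ∧-intro e refl
  chain-parts (x ∷ y ∷ r) e = ∧-intro (∧-elimˡ {isPart q x} e) (chain-parts (y ∷ r) (proj₂ (chain-step x y r e)))

  chain-divisor : ∀ d x y r → chainOK q (x ∷ y ∷ r) ≡ true →
    all (divB d) (y ∷ r) ≡ true → all (divB d) (x ∷ y ∷ r) ≡ true
  chain-divisor d x y r e h =
    ∧-intro (divB-complete d x (∣-trans (divB-sound d y (∧-elimˡ {divB d y} h)) (proj₁ (chain-step x y r e)))) h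

  -- In a chain of parts ≥ 2 either all parts are even or all are multiples of q,
  -- because the last part is.
  chain-uniform : ∀ l → chainOK q l ≡ true → all (2 ≤ᵇ_) l ≡ true →
    all (divB 2) l ≡ true ⊎ all (divB q) l ≡ true
  chain-uniform [] _ _ = inj₁ refl
  chain-uniform (x ∷ []) e ≥2 with part-divisor x e (≤ᵇ⇒≤ 2 x (true⇒T (∧-elimˡ {2 ≤ᵇ x} ≥2)))
  ... | inj₁ 2∣x = inj₁ (∧-intro (divB-complete 2 x 2∣x) refl)
  ... | inj₂ q∣x = inj₂ (∧-intro (divB-complete q x q∣x) refl)
  chain-uniform (x ∷ y ∷ r) e ≥2 with chain-uniform (y ∷ r) (proj₂ (chain-step x y r e)) (∧-elimʳ {2 ≤ᵇ x} ≥2)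
  ... | inj₁ h = inj₁ (chain-divisor 2 x y r e h)
  ... | inj₂ h = inj₂ (chain-divisor q x y r e h)

  multiple-parts-≥2 : ∀ {k} → 2 ≤ k → ∀ l → all (isPart q) l ≡ true → all (divB k) l ≡ true → all (2 ≤ᵇ_) l ≡ true
  multiple-parts-≥2 2≤k [] _ _ = refl
  multiple-parts-≥2 {k} 2≤k (x ∷ l) parts divs = ∧-intro (T⇒true (≤⇒≤ᵇ 2≤x))
    (multiple-parts-≥2 2≤k l (∧-elimʳ {isPart q x} parts) (∧-elimʳ {divB k x} divs))
    where
    instance
      x≢0 : NonZero x
      x≢0 = >-nonZero (part-positive x (∧-elimˡ {isPart q x} parts))
    2≤x : 2 ≤ x
    2≤x = ≤-trans 2≤k (∣⇒≤ (divB-sound k x (∧-elimˡ {divB k x} divs)))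

  IsPartitionᵇ : ℕ → List ℕ → Bool
  IsPartitionᵇ n l = (sum l ≡ᵇ n) ∧ chainOK q l

  W≥2 : ℕ → ℕ
  W≥2 n = countB (IsPartitionᵇ n) (sublists (Cand≥2 n))

  MultPartitionᵇ : ℕ → ℕ → List ℕ → Bool
  MultPartitionᵇ k n l = IsPartitionᵇ n l ∧ all (divB k) l

  Wmul : ℕ → ℕ → ℕ
  Wmul k n = countB (MultPartitionᵇ k n) (sublists (Cand n))

  MultPartition-sound : ∀ k n l → MultPartitionᵇ k n l ≡ true →
    sum l ≡ n × chainOK q l ≡ true × all (divB k) l ≡ true
  MultPartition-sound k n l e =
    ≡ᵇ⇒≡ _ _ (true⇒T (∧-elimˡ {sum l ≡ᵇ n} partition)) , ∧-elimʳ {sum l ≡ᵇ n} partition , ∧-elimʳ {IsPartitionᵇ n l} e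
    where
    partition : IsPartitionᵇ n l ≡ true
    partition = ∧-elimˡ {IsPartitionᵇ n l} e

  chainOK-∷ʳ1 : ∀ l → all (2 ≤ᵇ_) l ≡ true → chainOK q (l ++ [ 1 ]) ≡ chainOK q l
  chainOK-∷ʳ1 [] _ = refl
  chainOK-∷ʳ1 (x ∷ []) ≥2
    rewrite T⇒true (<⇒<ᵇ {1} {x} (≤ᵇ⇒≤ 2 x (true⇒T (∧-elimˡ {2 ≤ᵇ x} ≥2)))) | divB-complete 1 x (1∣ x) = ∧-identityʳ _
  chainOK-∷ʳ1 (x ∷ y ∷ r) ≥2 =
    cong (λ c → isPart q x ∧ (y <ᵇ x) ∧ divB y x ∧ c) (chainOK-∷ʳ1 (y ∷ r) (∧-elimʳ {2 ≤ᵇ x} ≥2))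

  IsPartition-∷ʳ1 : ∀ n l → all (2 ≤ᵇ_) l ≡ true → IsPartitionᵇ (suc n) (l ++ [ 1 ]) ≡ IsPartitionᵇ n l
  IsPartition-∷ʳ1 n l ≥2 rewrite sum-++ l [ 1 ] | +-comm (sum l) 1 | chainOK-∷ʳ1 l ≥2 = refl

  -- The candidate n+1 is too large to occur in a partition of n.
  drop-top-candidate : ∀ n → countB (IsPartitionᵇ n) (sublists (Cand≥2 (suc n))) ≡ W≥2 n
  drop-top-candidate zero = refl
  drop-top-candidate (suc m) = countSub-∷-unused _ (suc (suc m)) (Cand≥2 (suc m)) too-large
    where
    too-large : ∀ l → IsPartitionᵇ (suc m) (suc (suc m) ∷ l) ≡ false
    too-large l = cong (_∧ chainOK q (suc (suc m) ∷ l))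
      (¬true⇒false (λ e → <⇒≢ (s≤s (s≤s (m≤m+n m (sum l)))) (sym (≡ᵇ⇒≡ _ _ (true⇒T e)))))

  W-suc : ∀ n → W q (suc n) ≡ W≥2 n + W≥2 (suc n)
  W-suc n = begin
    W q (suc n)
      ≡⟨ cong (λ c → countB (IsPartitionᵇ (suc n)) (sublists c)) (Cand-suc n) ⟩
    countB (IsPartitionᵇ (suc n)) (sublists (Cand≥2 (suc n) ++ [ 1 ]))
      ≡⟨ countSub-∷ʳ _ (Cand≥2 (suc n)) 1 ⟩
    countB (λ l → IsPartitionᵇ (suc n) (l ++ [ 1 ])) (sublists (Cand≥2 (suc n))) + W≥2 (suc n)
      ≡⟨ cong (_+ W≥2 (suc n)) (countSub-cong (2 ≤ᵇ_) _ _ (Cand≥2 (suc n))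
                                  (all-filterᵇ (2 ≤ᵇ_) (Cand (suc n))) (IsPartition-∷ʳ1 n)) ⟩
    countB (IsPartitionᵇ n) (sublists (Cand≥2 (suc n))) + W≥2 (suc n)
      ≡⟨ cong (_+ W≥2 (suc n)) (drop-top-candidate n) ⟩
    W≥2 n + W≥2 (suc n) ∎
    where open ≡-Reasoning

  Wmul-vanish : ∀ k n → ¬ k ∣ n → Wmul k n ≡ 0
  Wmul-vanish k n k∤n = countB-none _ (sublists (Cand n)) λ l → ¬true⇒false λ e →
    let sum≡n , _ , divs = MultPartition-sound k n l e
    in k∤n (subst (k ∣_) sum≡n (all-divB⇒∣sum k l divs))

  Wmul-Cand≥2 : ∀ k → 2 ≤ k → ∀ n → Wmul k n ≡ countB (MultPartitionᵇ k n) (sublists (Cand≥2 n))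
  Wmul-Cand≥2 k 2≤k n = countSub-filter (2 ≤ᵇ_) _ (Cand n) λ l e →
    let _ , chain , divs = MultPartition-sound k n l e
    in multiple-parts-≥2 2≤k l (chain-parts l chain) divs

  chainOK-scale : ∀ k .{{_ : NonZero k}} → (∀ x → isPart q (k * x) ≡ isPart q x) →
    ∀ l → chainOK q (map (k *_) l) ≡ chainOK q l
  chainOK-scale k part-scale [] = refl
  chainOK-scale k part-scale (x ∷ []) = part-scale x
  chainOK-scale k part-scale (x ∷ y ∷ r) =
    cong₂ _∧_ (part-scale x) (cong₂ _∧_ (<ᵇ-scale k y x) (cong₂ _∧_ (divB-scale k y x) (chainOK-scale k part-scale (y ∷ r))))

  Wmul-scale : ∀ k .{{_ : NonZero k}} → (∀ x → isPart q (k * x) ≡ isPart q x) →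
    ∀ m → Wmul k (k * m) ≡ W q m
  Wmul-scale k part-scale m = begin
    Wmul k (k * m)
      ≡⟨ countSub-filter (divB k) _ (Cand (k * m)) (λ l e → proj₂ (proj₂ (MultPartition-sound k (k * m) l e))) ⟩
    countB (MultPartitionᵇ k (k * m)) (sublists (filterᵇ (divB k) (Cand (k * m))))
      ≡⟨ cong (λ c → countB (MultPartitionᵇ k (k * m)) (sublists c))
              (multiples-in-Cand k (k * m) m ≤-refl (m<m+n (k * m) (>-nonZero⁻¹ k))) ⟩
    countB (MultPartitionᵇ k (k * m)) (sublists (map (k *_) (Cand m)))
      ≡⟨ countSub-map _ (k *_) (Cand m) ⟩
    countB (λ l → MultPartitionᵇ k (k * m) (map (k *_) l)) (sublists (Cand m))
      ≡⟨ countB-cong _ (IsPartitionᵇ m) (sublists (Cand m)) scaled-test ⟩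
    W q m ∎
    where
    open ≡-Reasoning
    scaled-test : ∀ l → MultPartitionᵇ k (k * m) (map (k *_) l) ≡ IsPartitionᵇ m l
    scaled-test l rewrite sum-map* k l | ≡ᵇ-scale k (sum l) m | chainOK-scale k part-scale l | all-divB-map* k l =
      ∧-identityʳ _

-- From here on q is odd, so that 2 and q are coprime; this gives fact (b) and the
-- recurrences.

module OddModulus (q : ℕ) (1<q : 1 < q) (q-odd : q % 2 ≡ 1) where

  open Chains q 1<q
  open import Data.Integer using (-_; 1ℤ) renaming (+_ to pos; _+_ to _+ℤ_)

  2∤q : ¬ 2 ∣ q
  2∤q 2∣q = contradiction (trans (sym q-odd) (n∣m⇒m%n≡0 q 2 2∣q)) λ ()

  2<q : 2 < q
  2<q = ≤∧≢⇒< 1<q (λ 2≡q → 2∤q (subst (2 ∣_) 2≡q ∣-refl))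

  coprime-2-q : Coprime 2 q
  coprime-2-q {zero} (0∣2 , _) = contradiction (0∣⇒≡0 0∣2) λ ()
  coprime-2-q {1} _ = refl
  coprime-2-q {2} (_ , 2∣q) = contradiction 2∣q 2∤q
  coprime-2-q {suc (suc (suc _))} (i∣2 , _) = contradiction (∣⇒≤ i∣2) λ { (s≤s (s≤s ())) }

  odd-product : ∀ {n} → ¬ 2 ∣ n → ¬ 2 ∣ q * n
  odd-product 2∤n 2∣qn = 2∤n (coprime-divisor coprime-2-q 2∣qn)

  2∤q^ : ∀ b → ¬ 2 ∣ q ^ b
  2∤q^ zero 2∣1 = contradiction (∣1⇒≡1 2∣1) λ ()
  2∤q^ (suc b) = odd-product (2∤q^ b)

  q∤2^ : ∀ a → ¬ q ∣ 2 ^ a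
  q∤2^ zero q∣1 = ∤-below z<s 1<q q∣1
  q∤2^ (suc a) q∣2^1+a = q∤2^ a (coprime-divisor (coprime-sym coprime-2-q) q∣2^1+a)

  isPart-2* : ∀ x → isPart q (2 * x) ≡ isPart q x
  isPart-2* x = true-ext (λ e → isPart-complete x (halve (isPart-sound _ e)))
                         (λ e → isPart-complete _ (double (isPart-sound x e)))
    where
    halve : IsPart (2 * x) → IsPart x
    halve (zero , b , e) = contradiction (divides x (trans (sym (+-identityʳ (q ^ b))) (trans e (*-comm 2 x)))) (2∤q^ b)
    halve (suc a , b , e) = a , b , *-cancelˡ-≡ _ _ 2 (trans (sym (*-assoc 2 (2 ^ a) (q ^ b))) e)
    double : IsPart x → IsPart (2 * x)
    double (a , b , e) = suc a , b , trans (*-assoc 2 (2 ^ a) (q ^ b)) (cong (2 *_) e)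

  isPart-q* : ∀ x → isPart q (q * x) ≡ isPart q x
  isPart-q* x = true-ext (λ e → isPart-complete x (divide (isPart-sound _ e)))
                         (λ e → isPart-complete _ (multiply (isPart-sound x e)))
    where
    pull-q : ∀ y z → y * (q * z) ≡ q * (y * z)
    pull-q y z = trans (sym (*-assoc y q z)) (trans (cong (_* z) (*-comm y q)) (*-assoc q y z))
    divide : IsPart (q * x) → IsPart x
    divide (a , zero , e) = contradiction (divides x (trans (sym (*-identityʳ (2 ^ a))) (trans e (*-comm q x)))) (q∤2^ a)
    divide (a , suc b , e) = a , b , *-cancelˡ-≡ _ _ q (trans (sym (pull-q (2 ^ a) (q ^ b))) e)
    multiply : IsPart x → IsPart (q * x)
    multiply (a , b , e) = a , suc b , trans (pull-q (2 ^ a) (q ^ b)) (cong (q *_) e)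

  isPart-2q* : ∀ x → isPart q ((2 * q) * x) ≡ isPart q x
  isPart-2q* x = trans (cong (isPart q) (*-assoc 2 q x)) (trans (isPart-2* (q * x)) (isPart-q* x))

  instance
    2q≢0 : NonZero (2 * q)
    2q≢0 = m*n≢0 2 q

  Wmul-2 : ∀ m → Wmul 2 (2 * m) ≡ W q m
  Wmul-2 = Wmul-scale 2 isPart-2*

  Wmul-q : ∀ m → Wmul q (q * m) ≡ W q m
  Wmul-q = Wmul-scale q isPart-q*

  Wmul-2q : ∀ m → Wmul (2 * q) ((2 * q) * m) ≡ W q m
  Wmul-2q = Wmul-scale (2 * q) isPart-2q*

  divB-2q : ∀ x → divB (2 * q) x ≡ divB 2 x ∧ divB q x
  divB-2q x = true-ext
    (λ e → let 2q∣x = divB-sound (2 * q) x e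
           in ∧-intro (divB-complete 2 x (m*n∣⇒m∣ 2 q 2q∣x)) (divB-complete q x (m*n∣⇒n∣ 2 q 2q∣x)))
    (λ e → divB-complete (2 * q) x (2∣∧q∣⇒2q∣ (divB-sound 2 x (∧-elimˡ {divB 2 x} e)) (divB-sound q x (∧-elimʳ {divB 2 x} e))))
    where
    2∣∧q∣⇒2q∣ : 2 ∣ x → q ∣ x → 2 * q ∣ x
    2∣∧q∣⇒2q∣ 2∣x (divides c refl) = *-monoˡ-∣ q (coprime-divisor coprime-2-q (subst (2 ∣_) (*-comm c q) 2∣x))

  all-divB-2q : ∀ l → all (divB (2 * q)) l ≡ all (divB 2) l ∧ all (divB q) l
  all-divB-2q [] = refl
  all-divB-2q (x ∷ l) rewrite divB-2q x | all-divB-2q l = ∧-interchange (divB 2 x) (divB q x) _ _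

  W≥2-incl-excl : ∀ n → W≥2 n + Wmul (2 * q) n ≡ Wmul 2 n + Wmul q n
  W≥2-incl-excl n = begin
    W≥2 n + Wmul (2 * q) n
      ≡⟨ cong₂ _+_ (countSub-cong (2 ≤ᵇ_) _ _ (Cand≥2 n) (all-filterᵇ (2 ≤ᵇ_) (Cand n)) even-or-q-multiples)
                   (trans (Wmul-Cand≥2 (2 * q) 2≤2q n) (countB-cong _ _ S both)) ⟩
    countB (λ l → M2 l ∨ Mq l) S + countB (λ l → M2 l ∧ Mq l) S
      ≡⟨ countB-∨-∧ M2 Mq S ⟩
    countB M2 S + countB Mq S
      ≡⟨ cong₂ _+_ (Wmul-Cand≥2 2 ≤-refl n) (Wmul-Cand≥2 q 1<q n) ⟨
    Wmul 2 n + Wmul q n ∎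
    where
    open ≡-Reasoning
    S : List (List ℕ)
    S = sublists (Cand≥2 n)
    M2 Mq : List ℕ → Bool
    M2 = MultPartitionᵇ 2 n
    Mq = MultPartitionᵇ q n
    2≤2q : 2 ≤ 2 * q
    2≤2q = ≤-trans 1<q (m≤n*m q 2)
    even-or-q-multiples : ∀ l → all (2 ≤ᵇ_) l ≡ true → IsPartitionᵇ n l ≡ M2 l ∨ Mq l
    even-or-q-multiples l ≥2 = ∧-∨-cover _ _ _ λ e → chain-uniform l (∧-elimʳ {sum l ≡ᵇ n} e) ≥2
    both : ∀ l → MultPartitionᵇ (2 * q) n l ≡ M2 l ∧ Mq l
    both l = trans (cong (IsPartitionᵇ n l ∧_) (all-divB-2q l)) (∧-distribˡ-∧ (IsPartitionᵇ n l) _ _)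

  W≥2-coprime : ∀ n → ¬ q ∣ n → W≥2 n ≡ Wmul 2 n
  W≥2-coprime n q∤n = begin
    W≥2 n                   ≡⟨ +-identityʳ (W≥2 n) ⟨
    W≥2 n + 0               ≡⟨ cong (W≥2 n +_) (Wmul-vanish (2 * q) n (λ 2q∣n → q∤n (m*n∣⇒n∣ 2 q 2q∣n))) ⟨
    W≥2 n + Wmul (2 * q) n  ≡⟨ W≥2-incl-excl n ⟩
    Wmul 2 n + Wmul q n     ≡⟨ cong (Wmul 2 n +_) (Wmul-vanish q n q∤n) ⟩
    Wmul 2 n + 0            ≡⟨ +-identityʳ (Wmul 2 n) ⟩
    Wmul 2 n ∎
    where open ≡-Reasoning

  -- For odd U, a partition of q U has odd parts only, hence all parts multiples of q.
  W≥2-odd-multiple : ∀ U → ¬ 2 ∣ U → W≥2 (q * U) ≡ W q U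
  W≥2-odd-multiple U 2∤U = begin
    W≥2 (q * U)                      ≡⟨ +-identityʳ (W≥2 (q * U)) ⟨
    W≥2 (q * U) + 0                  ≡⟨ cong (W≥2 (q * U) +_) (Wmul-vanish (2 * q) _ (λ 2q∣ → 2∤qU (m*n∣⇒m∣ 2 q 2q∣))) ⟨
    W≥2 (q * U) + Wmul (2 * q) (q * U) ≡⟨ W≥2-incl-excl (q * U) ⟩
    Wmul 2 (q * U) + Wmul q (q * U)  ≡⟨ cong₂ _+_ (Wmul-vanish 2 (q * U) 2∤qU) (Wmul-q U) ⟩
    W q U ∎
    where
    open ≡-Reasoning
    2∤qU : ¬ 2 ∣ q * U
    2∤qU = odd-product 2∤U

  W≥2-even-multiple : ∀ v → W≥2 (q * (v * 2)) + W q v ≡ W q (q * v) + W q (v * 2)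
  W≥2-even-multiple v = begin
    W≥2 n + W q v                ≡⟨ cong (W≥2 n +_) (trans (sym (Wmul-2q v)) (cong (Wmul (2 * q)) n≡2q·v)) ⟩
    W≥2 n + Wmul (2 * q) n       ≡⟨ W≥2-incl-excl n ⟩
    Wmul 2 n + Wmul q n          ≡⟨ cong₂ _+_ (trans (cong (Wmul 2) n≡2·qv) (Wmul-2 (q * v))) (Wmul-q (v * 2)) ⟩
    W q (q * v) + W q (v * 2) ∎
    where
    open ≡-Reasoning
    open +-*-Solver using (solve; _:*_; _:=_; con)
    n : ℕ
    n = q * (v * 2)
    n≡2q·v : (2 * q) * v ≡ n
    n≡2q·v = solve 2 (λ q v → (con 2 :* q) :* v := q :* (v :* con 2)) refl q v
    n≡2·qv : n ≡ 2 * (q * v)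
    n≡2·qv = solve 2 (λ q v → q :* (v :* con 2) := con 2 :* (q :* v)) refl q v

  Wmul-2-even : ∀ {n} → 2 ∣ n → Wmul 2 n ≡ W q (n / 2)
  Wmul-2-even (divides m refl) = trans (cong (Wmul 2) (*-comm m 2)) (trans (Wmul-2 m) (cong (W q) (sym (m*n/n≡m m 2))))

  Wmul-2-consecutive : ∀ n → Wmul 2 n + Wmul 2 (suc n) ≡ W q (suc n / 2)
  Wmul-2-consecutive n with even-or-suc-even n
  ... | inj₁ 2∣n = begin
    Wmul 2 n + Wmul 2 (suc n)  ≡⟨ cong₂ _+_ (Wmul-2-even 2∣n) (Wmul-vanish 2 (suc n) (even⇒suc-odd 2∣n)) ⟩
    W q (n / 2) + 0            ≡⟨ +-identityʳ (W q (n / 2)) ⟩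
    W q (n / 2)                ≡⟨ cong (W q) (suc-even/2 2∣n) ⟨
    W q (suc n / 2) ∎
    where open ≡-Reasoning
  ... | inj₂ 2∣1+n = cong₂ _+_ (Wmul-vanish 2 n (λ 2∣n → even⇒suc-odd 2∣n 2∣1+n)) (Wmul-2-even 2∣1+n)

  W-between-multiples : ∀ n → ¬ q ∣ n → ¬ q ∣ suc n → W q (suc n) ≡ W q (suc n / 2)
  W-between-multiples n q∤n q∤1+n = begin
    W q (suc n)                ≡⟨ W-suc n ⟩
    W≥2 n + W≥2 (suc n)        ≡⟨ cong₂ _+_ (W≥2-coprime n q∤n) (W≥2-coprime (suc n) q∤1+n) ⟩
    Wmul 2 n + Wmul 2 (suc n)  ≡⟨ Wmul-2-consecutive n ⟩
    W q (suc n / 2) ∎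
    where open ≡-Reasoning

  -- Its inductive step reduces, via W-suc, to
  -- W≥2 (q U) = W U + W≥2 (q U - 2), which is shown separately for odd and even U.
  Recurrence-at : ℕ → Set
  Recurrence-at U = ∀ n → q * U ≡ suc n → W q (suc n) ≡ W q U + W q n

  q∤qU-2 : ∀ {U m} → q * U ≡ suc (suc m) → ¬ q ∣ m
  q∤qU-2 {U} {m} qU≡ q∣m = ∤-offset q∣m z<s 2<q (subst (q ∣_) (trans qU≡ (+-comm 2 m)) (m∣m*n U))

  -- Odd U: W≥2 (q U) = W U, while q U - 2 is odd and prime to q, so W≥2 (q U - 2) = 0.
  W≥2-step-odd : ∀ U m → ¬ 2 ∣ U → q * U ≡ suc (suc m) → W≥2 (suc (suc m)) ≡ W q U + W≥2 m
  W≥2-step-odd U m 2∤U qU≡ = begin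
    W≥2 (suc (suc m))  ≡⟨ cong W≥2 qU≡ ⟨
    W≥2 (q * U)        ≡⟨ W≥2-odd-multiple U 2∤U ⟩
    W q U              ≡⟨ +-identityʳ (W q U) ⟨
    W q U + 0          ≡⟨ cong (W q U +_) (trans (W≥2-coprime m (q∤qU-2 qU≡)) (Wmul-vanish 2 m 2∤m)) ⟨
    W q U + W≥2 m ∎
    where
    open ≡-Reasoning
    2∤m : ¬ 2 ∣ m
    2∤m 2∣m = odd-product 2∤U (subst (2 ∣_) (sym qU≡) (∣m∣n⇒∣m+n (∣-refl {2}) 2∣m))

  -- U = 2v with q v = w + 1: by W≥2-even-multiple and the recurrence at v,
  -- W≥2 (q U) = W U + W w, and W≥2 (q U - 2) = Wmul 2 (2 w) = W w.
  W≥2-step-even : ∀ v w m → q * v ≡ suc w → q * (v * 2) ≡ suc (suc m) →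
    W q (suc w) ≡ W q v + W q w → W≥2 (suc (suc m)) ≡ W q (v * 2) + W≥2 m
  W≥2-step-even v w m qv≡ qU≡ recurrence-v = +-cancelʳ-≡ (W q v) _ _ (begin
    W≥2 (suc (suc m)) + W q v      ≡⟨ cong (λ n → W≥2 n + W q v) qU≡ ⟨
    W≥2 (q * (v * 2)) + W q v      ≡⟨ W≥2-even-multiple v ⟩
    W q (q * v) + W q (v * 2)      ≡⟨ cong (λ n → W q n + W q (v * 2)) qv≡ ⟩
    W q (suc w) + W q (v * 2)      ≡⟨ cong (_+ W q (v * 2)) recurrence-v ⟩
    W q v + W q w + W q (v * 2)    ≡⟨ solve 3 (λ a b c → a :+ b :+ c := c :+ b :+ a) refl (W q v) (W q w) (W q (v * 2)) ⟩
    W q (v * 2) + W q w + W q v    ≡⟨ cong (λ x → W q (v * 2) + x + W q v) W≥2m≡Ww ⟨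
    W q (v * 2) + W≥2 m + W q v ∎)
    where
    open ≡-Reasoning
    open +-*-Solver using (solve; _:+_; _:=_)
    m≡2w : m ≡ 2 * w
    m≡2w = suc-injective (suc-injective (begin
      suc (suc m)   ≡⟨ qU≡ ⟨
      q * (v * 2)   ≡⟨ *-assoc q v 2 ⟨
      q * v * 2     ≡⟨ cong (_* 2) qv≡ ⟩
      suc w * 2     ≡⟨ *-comm (suc w) 2 ⟩
      2 * suc w     ≡⟨ *-suc 2 w ⟩
      suc (suc (2 * w)) ∎))
    W≥2m≡Ww : W≥2 m ≡ W q w
    W≥2m≡Ww = trans (W≥2-coprime m (q∤qU-2 qU≡)) (trans (cong (Wmul 2) m≡2w) (Wmul-2 w))

  recurrence-at : ∀ U → Recurrence-at U
  recurrence-at = <-rec Recurrence-at step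
    where
    W≥2-step : ∀ U m → q * U ≡ suc (suc m) → (∀ {v} → v < U → Recurrence-at v) → W≥2 (suc (suc m)) ≡ W q U + W≥2 m
    W≥2-step U m qU≡ ih with 2 ∣? U
    ... | no 2∤U = W≥2-step-odd U m 2∤U qU≡
    ... | yes (divides zero refl) = contradiction (trans (sym qU≡) (*-zeroʳ q)) λ ()
    ... | yes (divides (suc v) refl) with q * suc v in qv≡
    ...   | zero = contradiction qv≡ (≢-nonZero⁻¹ (q * suc v) {{m*n≢0 q (suc v)}})
    ...   | suc w = W≥2-step-even (suc v) w m qv≡ qU≡ (ih (m<m*n (suc v) 2 ≤-refl) w qv≡)
    step : ∀ U → (∀ {v} → v < U → Recurrence-at v) → Recurrence-at U
    step U ih zero qU≡1 = contradiction (subst (q ∣_) qU≡1 (m∣m*n U)) (∤-below z<s 1<q)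
    step U ih (suc m) qU≡ = begin
      W q (suc (suc m))                ≡⟨ W-suc (suc m) ⟩
      W≥2 (suc m) + W≥2 (suc (suc m))  ≡⟨ cong (W≥2 (suc m) +_) (W≥2-step U m qU≡ ih) ⟩
      W≥2 (suc m) + (W q U + W≥2 m)    ≡⟨ solve 3 (λ a b c → a :+ (b :+ c) := b :+ (c :+ a)) refl (W≥2 (suc m)) (W q U) (W≥2 m) ⟩
      W q U + (W≥2 m + W≥2 (suc m))    ≡⟨ cong (W q U +_) (W-suc m) ⟨
      W q U + W q (suc m) ∎
      where
      open ≡-Reasoning
      open +-*-Solver using (solve; _:+_; _:=_)

  -- The first recurrence in the form of the proposition (for U = 0 both sides are 1).
  first-recurrence : ∀ U → W q (q * U) ≡ W q U + Wℤ q (pos (q * U) +ℤ - 1ℤ)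
  first-recurrence zero rewrite *-zeroʳ q = refl
  first-recurrence (suc u) with q * suc u in qU≡
  ... | zero = contradiction qU≡ (≢-nonZero⁻¹ (q * suc u) {{m*n≢0 q (suc u)}})
  ... | suc n = recurrence-at (suc u) n qU≡

  q∤qU+1 : ∀ U → ¬ q ∣ suc (q * U)
  q∤qU+1 U q∣ = ∤-offset (m∣m*n U) z<s 1<q (subst (q ∣_) (+-comm 1 (q * U)) q∣)

  -- Even U = 2v: W (q U + 1) = W≥2 (q U) since q U + 1 is odd and prime to q.
  second-recurrence-even : ∀ U → 2 ∣ U → W q (q * U + 1) ≡ W q U + Wℤ q (pos ((q * U) / 2) +ℤ - 1ℤ)
  second-recurrence-even .(v * 2) (divides v refl) = begin
    W q (n + 1)                  ≡⟨ cong (W q) (+-comm n 1) ⟩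
    W q (suc n)                  ≡⟨ W-suc n ⟩
    W≥2 n + W≥2 (suc n)          ≡⟨ cong₂ _+_ W≥2n≡ (trans (W≥2-coprime (suc n) (q∤qU+1 (v * 2))) (Wmul-vanish 2 (suc n) 2∤1+n)) ⟩
    W q (v * 2) + X + 0          ≡⟨ +-identityʳ (W q (v * 2) + X) ⟩
    W q (v * 2) + X              ≡⟨ cong (λ h → W q (v * 2) + Wℤ q (pos h +ℤ - 1ℤ)) n/2≡qv ⟨
    W q (v * 2) + Wℤ q (pos (n / 2) +ℤ - 1ℤ) ∎
    where
    open ≡-Reasoning
    open +-*-Solver using (solve; _:+_; _:=_)
    n : ℕ
    n = q * (v * 2)
    X : ℕ
    X = Wℤ q (pos (q * v) +ℤ - 1ℤ)
    n/2≡qv : n / 2 ≡ q * v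
    n/2≡qv = trans (cong (_/ 2) (sym (*-assoc q v 2))) (m*n/n≡m (q * v) 2)
    2∤1+n : ¬ 2 ∣ suc n
    2∤1+n = even⇒suc-odd (∣n⇒∣m*n q (n∣m*n v))
    W≥2n≡ : W≥2 n ≡ W q (v * 2) + X
    W≥2n≡ = +-cancelʳ-≡ (W q v) _ _ (begin
      W≥2 n + W q v              ≡⟨ W≥2-even-multiple v ⟩
      W q (q * v) + W q (v * 2)  ≡⟨ cong (_+ W q (v * 2)) (first-recurrence v) ⟩
      W q v + X + W q (v * 2)    ≡⟨ solve 3 (λ a b c → a :+ b :+ c := c :+ b :+ a) refl (W q v) X (W q (v * 2)) ⟩
      W q (v * 2) + X + W q v ∎)

  second-recurrence-odd : ∀ U → ¬ 2 ∣ U → W q (q * U + 1) ≡ W q U + W q ((q * U + 1) / 2)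
  second-recurrence-odd U 2∤U = begin
    W q (q * U + 1)                        ≡⟨ cong (W q) (+-comm (q * U) 1) ⟩
    W q (suc (q * U))                      ≡⟨ W-suc (q * U) ⟩
    W≥2 (q * U) + W≥2 (suc (q * U))        ≡⟨ cong₂ _+_ (W≥2-odd-multiple U 2∤U) (W≥2-coprime _ (q∤qU+1 U)) ⟩
    W q U + Wmul 2 (suc (q * U))           ≡⟨ cong (W q U +_) (Wmul-2-even (odd⇒suc-even (odd-product 2∤U))) ⟩
    W q U + W q (suc (q * U) / 2)          ≡⟨ cong (λ h → W q U + W q (h / 2)) (+-comm 1 (q * U)) ⟩
    W q U + W q ((q * U + 1) / 2) ∎
    where open ≡-Reasoning

  -- For 2 ≤ r ≤ q - 1 both q U + r - 1 and q U + r lie strictly between multiples of q.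
  other-recurrences : ∀ U r → 2 ≤ r → r ≤ q ∸ 1 → W q (q * U + r) ≡ W q ((q * U + r) / 2)
  other-recurrences U (suc (suc s)) (s≤s (s≤s _)) r≤q-1 = begin
    W q (q * U + suc (suc s))          ≡⟨ cong (W q) (+-suc (q * U) (suc s)) ⟩
    W q (suc (q * U + suc s))          ≡⟨ W-between-multiples (q * U + suc s) (∤-offset q∣qU z<s (<-trans (n<1+n (suc s)) r<q)) q∤qU+r ⟩
    W q (suc (q * U + suc s) / 2)      ≡⟨ cong (λ h → W q (h / 2)) (+-suc (q * U) (suc s)) ⟨
    W q ((q * U + suc (suc s)) / 2) ∎
    where
    open ≡-Reasoning
    q∣qU : q ∣ q * U
    q∣qU = m∣m*n U
    r<q : suc (suc s) < q
    r<q = subst (suc (suc s) <_) (m+[n∸m]≡n (<-trans z<s 1<q)) (s≤s r≤q-1)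
    q∤qU+r : ¬ q ∣ suc (q * U + suc s)
    q∤qU+r = subst (λ h → ¬ q ∣ h) (+-suc (q * U) (suc s)) (∤-offset q∣qU z<s r<q)

open import Data.Integer using (+_; -_; 1ℤ) renaming (_+_ to _+ℤ_)

proposition4p1 : (q : ℕ) → 1 < q → q % 2 ≡ 1 → (U : ℕ) →
    (W q (q * U) ≡ W q U + Wℤ q ((+ (q * U)) +ℤ (- 1ℤ)))
    × (U % 2 ≡ 0 → W q (q * U + 1) ≡ W q U + Wℤ q ((+ ((q * U) / 2)) +ℤ (- 1ℤ)))
    × (U % 2 ≡ 1 → W q (q * U + 1) ≡ W q U + W q ((q * U + 1) / 2))
    × ((r : ℕ) → 2 ≤ r → r ≤ q ∸ 1 → W q (q * U + r) ≡ W q ((q * U + r) / 2))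
proposition4p1 q 1<q q-odd U =
    first-recurrence U
  , (λ U%2≡0 → second-recurrence-even U (m%n≡0⇒n∣m U 2 U%2≡0))
  , (λ U%2≡1 → second-recurrence-odd U (λ 2∣U → contradiction (trans (sym U%2≡1) (n∣m⇒m%n≡0 U 2 2∣U)) λ ()))
  , other-recurrences U
  where open OddModulus q 1<q q-odd
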